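{- Let $G$ be a graph with at least one vertex and maximum average degree less than $\frac{10}{3}$. Then $G$ contains at least one of the following configurations: (C1.1) a vertex $x$ of degree at most $1$; (C1.2) a vertex $x$ of degree $2$ adjacent to a vertex $y$ of degree at most $6$; (C1.3) a vertex $x$ of degree $3$ adjacent to a vertex $y$ of degree at most $4$ and to a vertex $z\ne y$ of degree at most $6$; (C1.4) a vertex $x$ of degree $i$, for some $i\in\{7,8,9\}$, adjacent to at least $i-1$ vertices of degree $2$.
   Context: The maximum average degree of $G$ is $\mathrm{mad}(G)=\max\{2|E(H)|/|V(H)|: H\subseteq G,\ |V(H)|\ge 1\}$. -}

module Defs where

import Data.Nat
open import Data.Nat using (ℕ; zero; suc; _+_; _*_; _<_; _≤_; _≡ᵇ_; _<ᵇ_)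
open import Data.Fin using (Fin; toℕ)
import Data.Fin as Fin
open import Data.Bool using (Bool; true; false; if_then_else_; _∧_; T)
open import Data.Product using (Σ; _×_; ∃; ∃-syntax)
open import Data.Sum using (_⊎_)
open import Relation.Nullary using (¬_)
open import Relation.Binary.PropositionalEquality using (_≡_; _≢_)
open import Function.Definitions using (Injective)

record Graph (n : ℕ) : Set where
  field
    adj   : Fin n → Fin n → Bool
    sym   : ∀ x y → adj x y ≡ adj y x
    irrefl : ∀ x → adj x x ≡ false
open Graph public

countB : ∀ {n} → (Fin n → Bool) → ℕ
countB {zero}  p = 0
countB {suc n} p = (if p Fin.zero then 1 else 0) + countB (λ i → p (Fin.suc i))

sumF : ∀ {n} → (Fin n → ℕ) → ℕ
sumF {zero}  f = 0
sumF {suc n} f = f Fin.zero + sumF (λ i → f (Fin.suc i))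

deg : ∀ {n} → Graph n → Fin n → ℕ
deg G x = countB (adj G x)

edges : ∀ {n} → Graph n → ℕ
edges {n} G = sumF (λ i → countB (λ j → adj G i j ∧ (toℕ i <ᵇ toℕ j)))

_⊆G_ : ∀ {m n} → Graph m → Graph n → Set
_⊆G_ {m} {n} H G = Σ (Fin m → Fin n) λ f →
  Injective _≡_ _≡_ f × (∀ i j → T (adj H i j) → T (adj G (f i) (f j)))

-- mad(G) < 10/3 : every subgraph H with |V(H)| ≥ 1 has 2|E(H)|/|V(H)| < 10/3,
-- i.e. 6|E(H)| < 10|V(H)|.
madLt10/3 : ∀ {n} → Graph n → Set
madLt10/3 {n} G = ∀ m (H : Graph m) → 1 ≤ m → H ⊆G G → 6 * edges H < 10 * m

deg2Nbrs : ∀ {n} → Graph n → Fin n → ℕ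
deg2Nbrs G x = countB (λ y → adj G x y ∧ (deg G y ≡ᵇ 2))

C1-1 C1-2 C1-3 C1-4 : ∀ {n} → Graph n → Set
C1-1 G = ∃[ x ] deg G x ≤ 1
C1-2 G = ∃[ x ] ∃[ y ] deg G x ≡ 2 × T (adj G x y) × deg G y ≤ 6
C1-3 G = ∃[ x ] ∃[ y ] ∃[ z ] deg G x ≡ 3 × T (adj G x y) × T (adj G x z)
           × y ≢ z × deg G y ≤ 4 × deg G z ≤ 6
C1-4 G = ∃[ x ] ∃[ i ] (i ≡ 7 ⊎ i ≡ 8 ⊎ i ≡ 9) × deg G x ≡ i
           × (i Data.Nat.∸ 1) ≤ deg2Nbrs G x

-- Discharging. Give every vertex the charge 18·deg; the total is 36|E|, and mad(G) < 10/3
-- forces it below 60|V|. A vertex of degree ≥ 7 sends 12 to each neighbour of degree 2 and 3 to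
-- each neighbour of degree 3; a vertex of degree 5 or 6 sends 2 to each neighbour of degree 3.
-- The total is preserved, and if none of the configurations occurs every vertex ends with
-- charge at least 60, so 60|V| ≤ 36|E|: a contradiction.
module Submission where

open import Defs hiding (sym)
open import Level using (0ℓ)
open import Function using (id; _∘_)
open import Data.Nat using (ℕ; zero; suc; _+_; _*_; _≤_; _<_; _≤″_; +-rawMagma; _<ᵇ_; _≡ᵇ_; z≤n; _≤?_)
open import Data.Nat.Properties hiding (_≟_)
open import Data.Fin using (Fin; toℕ)
import Data.Fin as Fin
open import Data.Fin.Properties using (_≟_; all?; any?; ¬∀⟶∃¬; toℕ-injective)
open import Data.Bool using (Bool; true; false; if_then_else_; _∧_; T)
open import Data.Bool.Properties using (T?)
open import Data.Unit using (tt)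
open import Data.Product using (_×_; _,_; ∃-syntax; proj₁; proj₂)
open import Data.Sum using (_⊎_; inj₁; inj₂; [_,_]′)
open import Relation.Nullary using (¬_; yes; no; does; contradiction; ¬?; _×-dec_)
open import Relation.Nullary.Reflects using (ofʸ; ofⁿ)
open import Relation.Unary using (Pred; Decidable)
open import Relation.Binary.PropositionalEquality
  using (_≡_; refl; sym; trans; cong; cong₂; subst₂; module ≡-Reasoning)
open import Algebra.Definitions.RawMagma +-rawMagma using (_,_)
open import Algebra.Properties.Semiring.Sum +-*-semiring
  using (sum; sum-cong-≗; ∑-distrib-+; ∑-comm; *-distribˡ-sum)

sum-mono : ∀ {n} {f g : Fin n → ℕ} → (∀ i → f i ≤ g i) → sum f ≤ sum g
sum-mono {zero}  f≤g = z≤n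
sum-mono {suc n} f≤g = +-mono-≤ (f≤g Fin.zero) (sum-mono (f≤g ∘ Fin.suc))

sum-const : ∀ {n} k → sum {n} (λ _ → k) ≡ k * n
sum-const {zero}  k = sym (*-zeroʳ k)
sum-const {suc n} k = trans (cong (k +_) (sum-const k)) (sym (*-suc k n))

sumF≡sum : ∀ {n} (f : Fin n → ℕ) → sumF f ≡ sum f
sumF≡sum {zero}  f = refl
sumF≡sum {suc n} f = cong (f Fin.zero +_) (sumF≡sum (f ∘ Fin.suc))

sumOver : ∀ {n} → (Fin n → Bool) → (Fin n → ℕ) → ℕ
sumOver p f = sum (λ i → if p i then f i else 0)

sumOver-const : ∀ {n} (p : Fin n → Bool) k → sumOver p (λ _ → k) ≡ k * countB p
sumOver-const {zero}  p k = sym (*-zeroʳ k)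
sumOver-const {suc n} p k with p Fin.zero
... | true  = trans (cong (k +_) (sumOver-const (p ∘ Fin.suc) k)) (sym (*-suc k _))
... | false = sumOver-const (p ∘ Fin.suc) k

countB≡sum : ∀ {n} (p : Fin n → Bool) → countB p ≡ sum (λ i → if p i then 1 else 0)
countB≡sum p = sym (trans (sumOver-const p 1) (*-identityˡ (countB p)))

sumOver-+ : ∀ {n} (p : Fin n → Bool) (f g : Fin n → ℕ) →
  sumOver p (λ i → f i + g i) ≡ sumOver p f + sumOver p g
sumOver-+ p f g =
  trans (sum-cong-≗ split) (∑-distrib-+ (λ i → if p i then f i else 0) (λ i → if p i then g i else 0))
  where
  split : ∀ i → (if p i then f i + g i else 0) ≡ (if p i then f i else 0) + (if p i then g i else 0)
  split i with p i
  ... | true  = refl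
  ... | false = refl

sumOver-mono : ∀ {n} (p : Fin n → Bool) {f g : Fin n → ℕ} →
  (∀ i → T (p i) → f i ≤ g i) → sumOver p f ≤ sumOver p g
sumOver-mono p {f} {g} f≤g = sum-mono pointwise
  where
  pointwise : ∀ i → (if p i then f i else 0) ≤ (if p i then g i else 0)
  pointwise i with p i | f≤g i
  ... | true  | f≤gᵢ = f≤gᵢ tt
  ... | false | _    = z≤n

sumOver-∧ : ∀ {n} (p q : Fin n → Bool) (f : Fin n → ℕ) →
  sumOver p (λ i → if q i then f i else 0) ≡ sumOver (λ i → p i ∧ q i) f
sumOver-∧ p q f = sum-cong-≗ pointwise
  where
  pointwise : ∀ i → (if p i then (if q i then f i else 0) else 0) ≡ (if p i ∧ q i then f i else 0)
  pointwise i with p i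
  ... | true  = refl
  ... | false = refl

sumOver≤sum : ∀ {n} (p : Fin n → Bool) (f : Fin n → ℕ) → sumOver p f ≤ sum f
sumOver≤sum p f = sum-mono pointwise
  where
  pointwise : ∀ i → (if p i then f i else 0) ≤ f i
  pointwise i with p i
  ... | true  = ≤-refl
  ... | false = z≤n

countB-≟ : ∀ {n} (y : Fin n) → countB (λ z → does (y ≟ z)) ≡ 1
countB-≟ {suc n} Fin.zero    = cong suc (countB-false {n})
  where
  countB-false : ∀ {m} → countB {m} (λ _ → false) ≡ 0
  countB-false {zero}  = refl
  countB-false {suc m} = countB-false {m}
countB-≟ {suc n} (Fin.suc y) = countB-≟ y

sumOver-singleton≤ : ∀ {n} (p : Fin n → Bool) (y : Fin n) k →
  sumOver p (λ z → if does (y ≟ z) then k else 0) ≤ k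
sumOver-singleton≤ p y k =
  ≤-trans (sumOver≤sum p (λ z → if does (y ≟ z) then k else 0)) (≤-reflexive (begin
  sumOver (λ z → does (y ≟ z)) (λ _ → k)  ≡⟨ sumOver-const (λ z → does (y ≟ z)) k ⟩
  k * countB (λ z → does (y ≟ z))         ≡⟨ cong (k *_) (countB-≟ y) ⟩
  k * 1                                   ≡⟨ *-identityʳ k ⟩
  k                                       ∎))
  where open ≡-Reasoning

slack-cancel : ∀ {a b c r s} → b + c ≤ a → a + r ≤ b + s → c + r ≤ s
slack-cancel {a} {b} {c} {r} {s} b+c≤a a+r≤b+s = +-cancelˡ-≤ b (c + r) s (begin
  b + (c + r)  ≡⟨ sym (+-assoc b c r) ⟩
  b + c + r    ≤⟨ +-monoˡ-≤ r b+c≤a ⟩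
  a + r        ≤⟨ a+r≤b+s ⟩
  b + s        ∎)
  where open ≤-Reasoning

pull-∀ : ∀ {n} {A : Set} {B : Pred (Fin n) 0ℓ} → Decidable B → (∀ x → A ⊎ B x) → A ⊎ (∀ x → B x)
pull-∀ {n} {B = B} B? A⊎B with all? B?
... | yes ∀B = inj₂ ∀B
... | no ¬∀B with ¬∀⟶∃¬ n B B? ¬∀B
...   | x , ¬Bx = [ inj₁ , (λ Bx → contradiction Bx ¬Bx) ]′ (A⊎B x)

module _ {n} (G : Graph n) where

  private
    below : Fin n → Fin n → ℕ
    below i j = if adj G i j ∧ (toℕ i <ᵇ toℕ j) then 1 else 0

  adjacency-split : ∀ i j → (if adj G i j then 1 else 0) ≡ below i j + below j i
  adjacency-split i j rewrite Graph.sym G j i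
    with adj G i j in i∼j
       | toℕ i <ᵇ toℕ j | <ᵇ-reflects-< (toℕ i) (toℕ j)
       | toℕ j <ᵇ toℕ i | <ᵇ-reflects-< (toℕ j) (toℕ i)
  ... | false | _     | _       | _     | _       = refl
  ... | true  | true  | _       | false | _       = refl
  ... | true  | false | _       | true  | _       = refl
  ... | true  | true  | ofʸ i<j | true  | ofʸ j<i = contradiction j<i (<⇒≯ i<j)
  ... | true  | false | ofⁿ i≮j | false | ofⁿ j≮i =
    contradiction (trans (sym i∼j) (trans (cong (adj G i) (sym i≡j)) (irrefl G i))) λ ()
    where
    i≡j : i ≡ j
    i≡j = toℕ-injective (≤-antisym (≮⇒≥ j≮i) (≮⇒≥ i≮j))

  handshake : sum (deg G) ≡ 2 * edges G
  handshake = begin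
    sum (deg G)
      ≡⟨ sum-cong-≗ (λ i → trans (countB≡sum (adj G i)) (sum-cong-≗ (adjacency-split i))) ⟩
    sum (λ i → sum (λ j → below i j + below j i))
      ≡⟨ sum-cong-≗ (λ i → ∑-distrib-+ (below i) (λ j → below j i)) ⟩
    sum (λ i → sum (below i) + sum (λ j → below j i))
      ≡⟨ ∑-distrib-+ (λ i → sum (below i)) (λ i → sum (λ j → below j i)) ⟩
    sum (λ i → sum (below i)) + sum (λ i → sum (λ j → below j i))
      ≡⟨ cong (sum (λ i → sum (below i)) +_) (∑-comm (λ i j → below j i)) ⟩
    sum (λ i → sum (below i)) + sum (λ i → sum (below i))
      ≡⟨ cong₂ _+_ edges≡ edges≡ ⟩
    edges G + edges G
      ≡⟨ cong (edges G +_) (sym (+-identityʳ (edges G))) ⟩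
    2 * edges G
      ∎
    where
    open ≡-Reasoning
    edges≡ : sum (λ i → sum (below i)) ≡ edges G
    edges≡ = sym (trans (sumF≡sum (λ i → countB (λ j → adj G i j ∧ (toℕ i <ᵇ toℕ j))))
                        (sum-cong-≗ (λ i → countB≡sum (λ j → adj G i j ∧ (toℕ i <ᵇ toℕ j)))))

  sumOver-adj-comm : (h : Fin n → Fin n → ℕ) →
    sum (λ x → sumOver (adj G x) (λ y → h y x)) ≡ sum (λ x → sumOver (adj G x) (h x))
  sumOver-adj-comm h = trans (∑-comm (λ x y → if adj G x y then h y x else 0))
    (sum-cong-≗ λ y → sum-cong-≗ λ x → cong (λ b → if b then h y x else 0) (Graph.sym G x y))

-- gift a b is sent by a vertex of degree a to each neighbour of degree b. A bound
-- k + gift d b ≤ 18 + gift b d says that the edge to a neighbour of degree b leaves at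
-- least k of its 18 units with the endpoint of degree d.
gift : ℕ → ℕ → ℕ
gift 5 3 = 2
gift 6 3 = 2
gift (suc (suc (suc (suc (suc (suc (suc _))))))) 2 = 12
gift (suc (suc (suc (suc (suc (suc (suc _))))))) 3 = 3
gift _ _ = 0

gift-to-2-from-7 : ∀ {b} → 7 ≤″ b → 30 + gift 2 b ≤ 18 + gift b 2
gift-to-2-from-7 (_ , refl) = ≤-refl

gift-to-3-from-5 : ∀ {b} → 5 ≤″ b → 20 + gift 3 b ≤ 18 + gift b 3
gift-to-3-from-5 (0 , refl)             = ≤-refl
gift-to-3-from-5 (1 , refl)             = ≤-refl
gift-to-3-from-5 (suc (suc _) , refl)   = n≤1+n 20

gift-to-3-from-7 : ∀ {b} → 7 ≤″ b → 21 + gift 3 b ≤ 18 + gift b 3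
gift-to-3-from-7 (_ , refl) = ≤-refl

gift-from-5-6≤2 : ∀ b → gift 5 b ≤ 2 × gift 6 b ≤ 2
gift-from-5-6≤2 0                         = z≤n , z≤n
gift-from-5-6≤2 1                         = z≤n , z≤n
gift-from-5-6≤2 2                         = z≤n , z≤n
gift-from-5-6≤2 3                         = ≤-refl , ≤-refl
gift-from-5-6≤2 (suc (suc (suc (suc _)))) = z≤n , z≤n

gift-from-7 : ∀ k b → 15 + gift (7 + k) b ≤ (if b ≡ᵇ 2 then 9 else 0) + (18 + gift b (7 + k))
gift-from-7 k 0                         = ≤ᵇ⇒≤ 15 18 _
gift-from-7 k 1                         = ≤ᵇ⇒≤ 15 18 _
gift-from-7 k 2                         = ≤-refl
gift-from-7 k 3                         = ≤-refl
gift-from-7 k (suc (suc (suc (suc _)))) = ≤-trans (≤ᵇ⇒≤ 15 18 _) (m≤m+n 18 _)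

gift≤2-balance : ∀ {a} b → gift a b ≤ 2 → 16 + gift a b ≤ 18 + gift b a
gift≤2-balance {a} b small = ≤-trans (+-monoʳ-≤ 16 small) (m≤m+n 18 (gift b a))

gift-from-7-crude : ∀ k b → 6 + gift (7 + k) b ≤ 18 + gift b (7 + k)
gift-from-7-crude k b = slack-cancel {a = 15} {b = 9} ≤-refl
  (≤-trans (gift-from-7 k b) (+-monoˡ-≤ (18 + gift b (7 + k)) (bonus≤9 (b ≡ᵇ 2))))
  where
  bonus≤9 : ∀ t → (if t then 9 else 0) ≤ 9
  bonus≤9 true  = ≤-refl
  bonus≤9 false = z≤n

⊆G-refl : ∀ {n} (G : Graph n) → G ⊆G G
⊆G-refl G = id , id , λ _ _ → id

Config : ∀ {n} → Graph n → Set
Config G = C1-1 G ⊎ C1-2 G ⊎ C1-3 G ⊎ C1-4 G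

module Discharging {n} (G : Graph n) where

  sent received : Fin n → ℕ
  sent     x = sumOver (adj G x) (λ y → gift (deg G x) (deg G y))
  received x = sumOver (adj G x) (λ y → gift (deg G y) (deg G x))

  Discharged : Pred (Fin n) 0ℓ
  Discharged x = 60 + sent x ≤ 18 * deg G x + received x

  discharged? : Decidable Discharged
  discharged? x = 60 + sent x ≤? 18 * deg G x + received x

  charge-bound : ∀ {x d} → deg G x ≡ d → ∀ k (bonus : Fin n → ℕ) →
    (∀ y → T (adj G x y) → k + gift d (deg G y) ≤ bonus y + (18 + gift (deg G y) d)) →
    k * d + sent x ≤ sumOver (adj G x) bonus + (18 * d + received x)
  charge-bound {x} refl k bonus h = begin
    k * deg G x + sent x
      ≡⟨ cong (_+ sent x) (sym (sumOver-const N k)) ⟩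
    sumOver N (λ _ → k) + sent x
      ≡⟨ sym (sumOver-+ N (λ _ → k) (λ y → gift (deg G x) (deg G y))) ⟩
    sumOver N (λ y → k + gift (deg G x) (deg G y))
      ≤⟨ sumOver-mono N h ⟩
    sumOver N (λ y → bonus y + (18 + gift (deg G y) (deg G x)))
      ≡⟨ sumOver-+ N bonus (λ y → 18 + gift (deg G y) (deg G x)) ⟩
    sumOver N bonus + sumOver N (λ y → 18 + gift (deg G y) (deg G x))
      ≡⟨ cong (sumOver N bonus +_) (sumOver-+ N (λ _ → 18) (λ y → gift (deg G y) (deg G x))) ⟩
    sumOver N bonus + (sumOver N (λ _ → 18) + received x)
      ≡⟨ cong (λ t → sumOver N bonus + (t + received x)) (sumOver-const N 18) ⟩
    sumOver N bonus + (18 * deg G x + received x)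
      ∎
    where
    open ≤-Reasoning
    N = adj G x

  discharged : ∀ {x d} → deg G x ≡ d → ∀ k B (bonus : Fin n → ℕ) →
    B + 60 ≤ k * d → sumOver (adj G x) bonus ≤ B →
    (∀ y → T (adj G x y) → k + gift d (deg G y) ≤ bonus y + (18 + gift (deg G y) d)) →
    60 + sent x ≤ 18 * d + received x
  discharged {x} eq k B bonus slack bonus≤B h =
    slack-cancel slack (≤-trans (charge-bound eq k bonus h) (+-monoˡ-≤ _ bonus≤B))

  discharged₀ : ∀ {x d} → deg G x ≡ d → ∀ k → 60 ≤ k * d →
    (∀ y → T (adj G x y) → k + gift d (deg G y) ≤ 18 + gift (deg G y) d) →
    60 + sent x ≤ 18 * d + received x
  discharged₀ {x} eq k slack =
    discharged eq k 0 (λ _ → 0) slack (≤-reflexive (sumOver-const (adj G x) 0))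

  neighbour? : ∀ x {P : Pred (Fin n) 0ℓ} → Decidable P →
    (∃[ y ] T (adj G x y) × P y) ⊎ (∀ y → T (adj G x y) → ¬ P y)
  neighbour? x P? with any? (λ y → T? (adj G x y) ×-dec P? y)
  ... | yes (y , x∼y , Py) = inj₁ (y , x∼y , Py)
  ... | no ∄y              = inj₂ λ y x∼y Py → ∄y (y , x∼y , Py)

  high-degree : ∀ {x} k → deg G x ≡ 7 + k → (7 + k ≡ 7 ⊎ 7 + k ≡ 8 ⊎ 7 + k ≡ 9) →
    9 * (5 + k) + 60 ≤ 15 * (7 + k) → Config G ⊎ 60 + sent x ≤ 18 * (7 + k) + received x
  high-degree {x} k eq range slack with 6 + k ≤? deg2Nbrs G x
  ... | yes many = inj₁ (inj₂ (inj₂ (inj₂ (x , 7 + k , range , eq , many))))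
  ... | no few   =
    inj₂ (discharged eq 15 (9 * (5 + k)) bonus slack bonus≤ λ y _ → gift-from-7 k (deg G y))
    where
    -- A neighbour of degree 2 leaves only 6; the bonus 9 makes up for it.
    bonus : Fin n → ℕ
    bonus y = if deg G y ≡ᵇ 2 then 9 else 0
    bonus≤ : sumOver (adj G x) bonus ≤ 9 * (5 + k)
    bonus≤ = begin
      sumOver (adj G x) bonus
        ≡⟨ sumOver-∧ (adj G x) (λ y → deg G y ≡ᵇ 2) (λ _ → 9) ⟩
      sumOver (λ y → adj G x y ∧ (deg G y ≡ᵇ 2)) (λ _ → 9)
        ≡⟨ sumOver-const (λ y → adj G x y ∧ (deg G y ≡ᵇ 2)) 9 ⟩
      9 * deg2Nbrs G x
        ≤⟨ *-monoʳ-≤ 9 (≤-pred (≰⇒> few)) ⟩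
      9 * (5 + k)
        ∎
      where open ≤-Reasoning

  config-or-discharged : ∀ x d → deg G x ≡ d → Config G ⊎ 60 + sent x ≤ 18 * d + received x
  config-or-discharged x 0 eq = inj₁ (inj₁ (x , ≤-trans (≤-reflexive eq) z≤n))
  config-or-discharged x 1 eq = inj₁ (inj₁ (x , ≤-reflexive eq))
  config-or-discharged x 2 eq with neighbour? x (λ y → deg G y ≤? 6)
  ... | inj₁ (y , x∼y , low) = inj₁ (inj₂ (inj₁ (x , y , eq , x∼y , low)))
  ... | inj₂ high = inj₂ (discharged₀ eq 30 ≤-refl λ y x∼y →
    gift-to-2-from-7 (≤⇒≤″ (≰⇒> (high y x∼y))))
  config-or-discharged x 3 eq with neighbour? x (λ y → deg G y ≤? 4)
  ... | inj₂ high = inj₂ (discharged₀ eq 20 ≤-refl λ y x∼y →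
    gift-to-3-from-5 (≤⇒≤″ (≰⇒> (high y x∼y))))
  ... | inj₁ (y , x∼y , low) with neighbour? x (λ z → ¬? (y ≟ z) ×-dec deg G z ≤? 6)
  ...   | inj₁ (z , x∼z , y≢z , mid) =
    inj₁ (inj₂ (inj₂ (inj₁ (x , y , z , eq , x∼y , x∼z , y≢z , low , mid))))
  ...   | inj₂ high =
    inj₂ (discharged eq 21 3 bonus ≤-refl (sumOver-singleton≤ (adj G x) y 3) per-neighbour)
    where
    -- The low neighbour y leaves 18, each of the two others at least 21.
    bonus : Fin n → ℕ
    bonus z = if does (y ≟ z) then 3 else 0
    per-neighbour : ∀ z → T (adj G x z) → 21 + gift 3 (deg G z) ≤ bonus z + (18 + gift (deg G z) 3)
    per-neighbour z x∼z with y ≟ z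
    ... | yes _   = m≤m+n 21 _
    ... | no y≢z = gift-to-3-from-7 (≤⇒≤″ (≰⇒> (λ mid → high z x∼z (y≢z , mid))))
  config-or-discharged x 4 eq = inj₂ (discharged₀ eq 16 (≤ᵇ⇒≤ 60 64 _) λ y _ →
    gift≤2-balance (deg G y) z≤n)
  config-or-discharged x 5 eq = inj₂ (discharged₀ eq 16 (≤ᵇ⇒≤ 60 80 _) λ y _ →
    gift≤2-balance (deg G y) (proj₁ (gift-from-5-6≤2 (deg G y))))
  config-or-discharged x 6 eq = inj₂ (discharged₀ eq 16 (≤ᵇ⇒≤ 60 96 _) λ y _ →
    gift≤2-balance (deg G y) (proj₂ (gift-from-5-6≤2 (deg G y))))
  config-or-discharged x 7 eq = high-degree 0 eq (inj₁ refl) ≤-refl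
  config-or-discharged x 8 eq = high-degree 1 eq (inj₂ (inj₁ refl)) (≤ᵇ⇒≤ 114 120 _)
  config-or-discharged x 9 eq = high-degree 2 eq (inj₂ (inj₂ refl)) (≤ᵇ⇒≤ 123 135 _)
  config-or-discharged x (suc (suc (suc (suc (suc (suc (suc (suc (suc (suc k)))))))))) eq =
    inj₂ (discharged₀ eq 6 (*-monoʳ-≤ 6 (m≤m+n 10 k)) λ y _ → gift-from-7-crude (3 + k) (deg G y))

  all-discharged⇒dense : (∀ x → Discharged x) → 60 * n ≤ 36 * edges G
  all-discharged⇒dense everywhere = +-cancelʳ-≤ (sum sent) (60 * n) (36 * edges G) (begin
    60 * n + sum sent
      ≡⟨ cong (_+ sum sent) (sym (sum-const {n} 60)) ⟩
    sum {n} (λ _ → 60) + sum sent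
      ≡⟨ sym (∑-distrib-+ (λ _ → 60) sent) ⟩
    sum (λ x → 60 + sent x)
      ≤⟨ sum-mono everywhere ⟩
    sum (λ x → 18 * deg G x + received x)
      ≡⟨ ∑-distrib-+ (λ x → 18 * deg G x) received ⟩
    sum (λ x → 18 * deg G x) + sum received
      ≡⟨ cong₂ _+_ (sym (*-distribˡ-sum 18 (deg G)))
                   (sumOver-adj-comm G (λ x y → gift (deg G x) (deg G y))) ⟩
    18 * sum (deg G) + sum sent
      ≡⟨ cong (λ t → 18 * t + sum sent) (handshake G) ⟩
    18 * (2 * edges G) + sum sent
      ≡⟨ cong (_+ sum sent) (sym (*-assoc 18 2 (edges G))) ⟩
    36 * edges G + sum sent
      ∎)
    where open ≤-Reasoning

lemma3p2 : ∀ {n} (G : Graph n) → 1 ≤ n → madLt10/3 G →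
    C1-1 G ⊎ C1-2 G ⊎ C1-3 G ⊎ C1-4 G
lemma3p2 {n} G n≥1 mad =
  [ id , (λ everywhere → contradiction (all-discharged⇒dense everywhere) (<⇒≱ sparse)) ]′
    (pull-∀ discharged? (λ x → config-or-discharged x (deg G x) refl))
  where
  open Discharging G
  sparse : 36 * edges G < 60 * n
  sparse = subst₂ _<_ (sym (*-assoc 6 6 (edges G))) (sym (*-assoc 6 10 n))
                  (*-monoʳ-< 6 (mad n G n≥1 (⊆G-refl G)))
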